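{- Suppose that $Q$ is a basic sequence and $x\in[0,1)$ is strongly $Q$-normal. Then $x$ is $Q$-normal.
   Context: A basic sequence is a sequence $Q=\{q_n\}_{n\ge1}$ of integers with $q_n\ge 2$ for all $n$. The $Q$-Cantor series expansion of $x\in[0,1)$ is the unique expansion $x=\sum_{n\ge1}\frac{E_n}{q_1q_2\cdots q_n}$ with $E_n\in\{0,1,\dots,q_n-1\}$ and $E_n\neq q_n-1$ for infinitely many $n$. A block of length $k$ is an ordered $k$-tuple of non-negative integers. For a block $B$ of length $k$, $N_n^Q(B,x)$ is the number of $j\in\{1,\dots,n\}$ with $(E_j,\dots,E_{j+k-1})=B$, and $Q_n^{(k)}=\sum_{j=1}^n \frac{1}{q_j\cdots q_{j+k-1}}$. $x$ is $Q$-normal of order $k$ if $N_n^Q(B,x)/Q_n^{(k)}\to1$ for every block $B$ of length $k$, and $Q$-normal if this holds for all $k\ge1$. Let $\rho(n,k)=\lceil n/k\rceil-1$. For a block $B$ of length $k$ and $p\in\{1,\dots,k\}$, $N_{n,p}^Q(B,x)$ is the number of integers $j$ with $0\le j<n/k$ such that $(E_{jk+p},\dots,E_{jk+p+k-1})=B$, and $Q_{n,p}^{(k)}=\sum_{j=0}^{\rho(n,k)}\frac{1}{q_{jk+p}\cdots q_{jk+p+k-1}}$. $x$ is strongly $Q$-normal of order $k$ if for every block $B$ of length $m\le k$ and every $p\in\{1,\dots,m\}$, $N_{n,p}^Q(B,x)/Q_{n,p}^{(m)}\to1$; $x$ is strongly $Q$-normal if it is strongly $Q$-normal of order $k$ for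 all $k\ge1$. -}

module Defs where

open import Data.Nat as ℕ using (ℕ; zero; suc; _+_; _*_; _∸_)
open import Data.Nat.DivMod using (_/_)
open import Data.List using (List; []; _∷_; map; upTo; length; foldr)
open import Data.List.Properties using (≡-dec)
open import Data.Integer using (+_)
open import Data.Rational as ℚ using (ℚ; 0ℚ; 1ℚ)
open import Data.Product using (_×_; ∃)
open import Relation.Nullary using (yes; no; ¬_)
open import Relation.Binary.PropositionalEquality using (_≡_; _≢_)

-- Sequences are indexed from 1; the value at index 0 is never used.

IsBasic : (ℕ → ℕ) → Set
IsBasic q = ∀ n → 1 ℕ.≤ n → 2 ℕ.≤ q n

-- E = (E_n)_{n ≥ 1} is the digit sequence of the Q-Cantor series expansion
-- of some x ∈ [0,1): E_n ∈ {0,…,q_n - 1} and E_n ≠ q_n - 1 infinitely often.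
-- (Such digit sequences are in bijection with x ∈ [0,1).)
IsCantorDigits : (ℕ → ℕ) → (ℕ → ℕ) → Set
IsCantorDigits q E =
  (∀ n → 1 ℕ.≤ n → E n ℕ.< q n) ×
  (∀ m → ∃ λ n → m ℕ.≤ n × 1 ℕ.≤ n × suc (E n) ≢ q n)

window : (ℕ → ℕ) → ℕ → ℕ → List ℕ
window E j k = map (λ i → E (j + i)) (upTo k)

prodQ : (ℕ → ℕ) → ℕ → ℕ → ℕ
prodQ q j k = foldr _*_ 1 (map (λ i → q (j + i)) (upTo k))

-- 1 / m as a rational (m = 0 never occurs for basic sequences)
recip : ℕ → ℚ
recip zero    = 0ℚ
recip (suc m) = (+ 1) ℚ./ suc m

-- division of rationals (totalised by 0 at a zero denominator,
-- which never occurs in the uses below)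
_÷_ : ℚ → ℚ → ℚ
a ÷ b with b ℚ.≟ 0ℚ
... | yes _  = 0ℚ
... | no b≢0 = ℚ._÷_ a b {{ℚ.≢-nonZero b≢0}}

sumℚ : List ℚ → ℚ
sumℚ = foldr ℚ._+_ 0ℚ

countWhere : (ℕ → List ℕ) → List ℕ → List ℕ → ℕ
countWhere w B []       = 0
countWhere w B (j ∷ js) with ≡-dec ℕ._≟_ (w j) B
... | yes _ = suc (countWhere w B js)
... | no _  = countWhere w B js

oneTo : ℕ → List ℕ
oneTo n = map suc (upTo n)

Nc : (ℕ → ℕ) → List ℕ → ℕ → ℕ
Nc E B n = countWhere (λ j → window E j (length B)) B (oneTo n)

Qk : (ℕ → ℕ) → ℕ → ℕ → ℚ
Qk q k n = sumℚ (map (λ j → recip (prodQ q j k)) (oneTo n))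

-- integers j with 0 ≤ j < n/k, i.e. j * k < n  (for k ≥ 1)
jsBelow : ℕ → ℕ → List ℕ
jsBelow n k = filterLt (upTo n)
  where
  filterLt : List ℕ → List ℕ
  filterLt [] = []
  filterLt (j ∷ js) with (j * k) ℕ.<? n
  ... | yes _ = j ∷ filterLt js
  ... | no _  = filterLt js

-- ρ(n,k) = ⌈n/k⌉ - 1, for k = suc k'
ρ : ℕ → ℕ → ℕ
ρ n zero     = 0
ρ n (suc k') = ((n + k') / suc k') ∸ 1

Np : (ℕ → ℕ) → List ℕ → ℕ → ℕ → ℕ
Np E B n p = countWhere (λ j → window E (j * k + p) k) B (jsBelow n k)
  where k = length B

Qp : (ℕ → ℕ) → ℕ → ℕ → ℕ → ℚ
Qp q k n p = sumℚ (map (λ j → recip (prodQ q (j * k + p) k)) (upTo (suc (ρ n k))))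

TendsToOne : (ℕ → ℚ) → Set
TendsToOne a = ∀ (ε : ℚ) → 0ℚ ℚ.< ε →
  ∃ λ N → ∀ n → N ℕ.≤ n → ℚ.∣ a n ℚ.- 1ℚ ∣ ℚ.< ε

IsQNormalOfOrder : (ℕ → ℕ) → (ℕ → ℕ) → ℕ → Set
IsQNormalOfOrder q E k = ∀ (B : List ℕ) → length B ≡ k →
  TendsToOne (λ n → ((+ Nc E B n) ℚ./ 1) ÷ Qk q k n)

IsQNormal : (ℕ → ℕ) → (ℕ → ℕ) → Set
IsQNormal q E = ∀ k → 1 ℕ.≤ k → IsQNormalOfOrder q E k

IsStronglyQNormalOfOrder : (ℕ → ℕ) → (ℕ → ℕ) → ℕ → Set
IsStronglyQNormalOfOrder q E k = ∀ (B : List ℕ) → length B ℕ.≤ k →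
  ∀ p → 1 ℕ.≤ p → p ℕ.≤ length B →
  TendsToOne (λ n → ((+ Np E B n p) ℚ./ 1) ÷ Qp q (length B) n p)

IsStronglyQNormal : (ℕ → ℕ) → (ℕ → ℕ) → Set
IsStronglyQNormal q E = ∀ k → 1 ℕ.≤ k → IsStronglyQNormalOfOrder q E k

-- Fix a block B of length L ≥ 1. Along n = mL the window positions 1, …, n split into the
-- L residue classes mod L, so N_n(B) = Σ_p N_{n,p}(B) and Q_n^{(L)} = Σ_p Q_{n,p}^{(L)};
-- strong normality makes every summand ratio tend to 1, hence N_n(B) ~ Q_n^{(L)} along
-- multiples of L. Between consecutive multiples M < n ≤ M + L both N and Q are monotone,
-- and Q grows by at most L · 2^{-L} ≤ ½ because q_j ≥ 2. If N does not change on the window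
-- the ratio stays within the errors at the endpoints; if N jumps by at least 1, then Q_M is already of
-- order 1/δ, so a change of ½ in Q is negligible.

module Submission where

open import Defs
open import Algebra.Bundles using (CommutativeSemigroup)
open import Algebra.Structures using (IsCommutativeMonoid)
import Algebra.Properties.CommutativeSemigroup as CommutativeSemigroupProperties
open import Data.Nat as ℕ using (ℕ; zero; suc)
import Data.Nat.Properties as ℕP
open import Data.List using (length)
open import Data.Product using (_×_; _,_; proj₁; proj₂; ∃)
import Data.Rational.Properties as ℚP
open import Data.Rational.Solver using (module +-*-Solver)
open import Function using (_∘_; id)
open import Relation.Nullary using (yes; no; contradiction)
open import Relation.Binary.PropositionalEquality

module FiniteSum {A : Set} {_∙_ : A → A → A} {ε : A}
                 (isCommutativeMonoid : IsCommutativeMonoid _≡_ _∙_ ε) where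

  open import Data.Nat using (_+_; _*_)
  open IsCommutativeMonoid isCommutativeMonoid using (assoc; identityˡ; isCommutativeSemigroup)
  private
    commutativeSemigroup : CommutativeSemigroup _ _
    commutativeSemigroup = record { isCommutativeSemigroup = isCommutativeSemigroup }

  open CommutativeSemigroupProperties commutativeSemigroup using (interchange)

  sumBelow : ℕ → (ℕ → A) → A
  sumBelow zero    f = ε
  sumBelow (suc n) f = f 0 ∙ sumBelow n (f ∘ suc)

  sumBelow-cong : ∀ n {f g} → (∀ i → f i ≡ g i) → sumBelow n f ≡ sumBelow n g
  sumBelow-cong zero    f≗g = refl
  sumBelow-cong (suc n) f≗g = cong₂ _∙_ (f≗g 0) (sumBelow-cong n (f≗g ∘ suc))

  sumBelow-ε : ∀ n → sumBelow n (λ _ → ε) ≡ ε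
  sumBelow-ε zero    = refl
  sumBelow-ε (suc n) = trans (cong (ε ∙_) (sumBelow-ε n)) (identityˡ ε)

  sumBelow-distrib : ∀ n f g → sumBelow n (λ i → f i ∙ g i) ≡ sumBelow n f ∙ sumBelow n g
  sumBelow-distrib zero    f g = sym (identityˡ ε)
  sumBelow-distrib (suc n) f g =
    trans (cong ((f 0 ∙ g 0) ∙_) (sumBelow-distrib n (f ∘ suc) (g ∘ suc))) (interchange _ _ _ _)

  sumBelow-+ : ∀ m n f → sumBelow (m + n) f ≡ sumBelow m f ∙ sumBelow n (λ i → f (m + i))
  sumBelow-+ zero    n f = sym (identityˡ _)
  sumBelow-+ (suc m) n f = trans (cong (f 0 ∙_) (sumBelow-+ m n (f ∘ suc))) (sym (assoc _ _ _))

  sumBelow-residues : ∀ m k f →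
    sumBelow (m * k) f ≡ sumBelow k (λ p → sumBelow m (λ j → f (j * k + p)))
  sumBelow-residues zero    k f = sym (sumBelow-ε k)
  sumBelow-residues (suc m) k f = begin
    sumBelow (k + m * k) f
      ≡⟨ sumBelow-+ k (m * k) f ⟩
    sumBelow k f ∙ sumBelow (m * k) (λ i → f (k + i))
      ≡⟨ cong (sumBelow k f ∙_) (sumBelow-residues m k (λ i → f (k + i))) ⟩
    sumBelow k f ∙ sumBelow k (λ p → sumBelow m (λ j → f (k + (j * k + p))))
      ≡⟨ cong (sumBelow k f ∙_) (sumBelow-cong k λ p → sumBelow-cong m λ j →
           cong f (sym (ℕP.+-assoc k (j * k) p))) ⟩
    sumBelow k f ∙ sumBelow k (λ p → sumBelow m (λ j → f (suc j * k + p)))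
      ≡⟨ sym (sumBelow-distrib k f _) ⟩
    sumBelow k (λ p → sumBelow (suc m) (λ j → f (j * k + p))) ∎
    where open ≡-Reasoning

module ℕΣ = FiniteSum ℕP.+-0-isCommutativeMonoid
module ℚΣ = FiniteSum ℚP.+-0-isCommutativeMonoid

module RelativeError where

  open import Data.Nat.Coprimality using (1-coprimeTo)
  import Data.Nat.Coprimality as Coprimality
  open import Data.Integer as ℤ using (+_)
  import Data.Integer.Properties as ℤP
  open import Data.Rational using (ℚ; mkℚ; 0ℚ; 1ℚ; _+_; _*_; _-_; -_; _<_; _≤_; ∣_∣; *≤*)
  import Data.Rational as ℚ
  open import Data.Rational.Properties
  open import Data.Sum using (_⊎_; inj₁; inj₂)
  open import Relation.Nullary.Decidable using (toWitness)
  open +-*-Solver using (solve; _:=_; _:+_; _:*_; _:-_; :-_; con)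

  fromℕ : ℕ → ℚ
  fromℕ n = + n ℚ./ 1

  fromℕ≡mkℚ : ∀ n → fromℕ n ≡ mkℚ (+ n) 0 (Coprimality.sym (1-coprimeTo n))
  fromℕ≡mkℚ n = normalize-coprime (Coprimality.sym (1-coprimeTo n))

  fromℕ-+ : ∀ m n → fromℕ (m ℕ.+ n) ≡ fromℕ m + fromℕ n
  fromℕ-+ m n = sym (begin
    fromℕ m + fromℕ n
      ≡⟨ cong₂ _+_ (fromℕ≡mkℚ m) (fromℕ≡mkℚ n) ⟩
    (+ m ℤ.* + 1 ℤ.+ + n ℤ.* + 1) ℚ./ 1
      ≡⟨ cong (ℚ._/ 1) (cong₂ ℤ._+_ (ℤP.*-identityʳ (+ m)) (ℤP.*-identityʳ (+ n))) ⟩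
    fromℕ (m ℕ.+ n) ∎)
    where open ≡-Reasoning

  fromℕ-* : ∀ m n → fromℕ (m ℕ.* n) ≡ fromℕ m * fromℕ n
  fromℕ-* m n = sym (trans (cong₂ _*_ (fromℕ≡mkℚ m) (fromℕ≡mkℚ n))
                           (cong (ℚ._/ 1) (sym (ℤP.pos-* m n))))

  fromℕ-suc : ∀ n → fromℕ (suc n) ≡ fromℕ n + 1ℚ
  fromℕ-suc n = trans (cong fromℕ (ℕP.+-comm 1 n)) (fromℕ-+ n 1)

  fromℕ-mono-≤ : ∀ {m n} → m ℕ.≤ n → fromℕ m ≤ fromℕ n
  fromℕ-mono-≤ {m} {n} m≤n = subst₂ _≤_ (sym (fromℕ≡mkℚ m)) (sym (fromℕ≡mkℚ n))
    (*≤* (subst₂ ℤ._≤_ (sym (ℤP.*-identityʳ (+ m))) (sym (ℤP.*-identityʳ (+ n))) (ℤ.+≤+ m≤n)))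

  fromℕ-nonNeg : ∀ n → 0ℚ ≤ fromℕ n
  fromℕ-nonNeg n = fromℕ-mono-≤ {0} {n} ℕ.z≤n

  fromℕ-jump : ∀ {m n} → m ℕ.≤ n → fromℕ n ≡ fromℕ m ⊎ fromℕ m + 1ℚ ≤ fromℕ n
  fromℕ-jump {m} {n} m≤n with ℕP.m≤n⇒m<n∨m≡n m≤n
  ... | inj₁ m<n = inj₂ (subst (_≤ fromℕ n) (fromℕ-suc m) (fromℕ-mono-≤ m<n))
  ... | inj₂ m≡n = inj₁ (cong fromℕ (sym m≡n))

  recip-nonNeg : ∀ P → 0ℚ ≤ recip P
  recip-nonNeg zero    = ≤-refl
  recip-nonNeg (suc m) = nonNegative⁻¹ _ {{normalize-nonNeg 1 (suc m)}}

  recip-pos : ∀ {P} → 1 ℕ.≤ P → 0ℚ < recip P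
  recip-pos {suc m} _ = positive⁻¹ _ {{normalize-pos 1 (suc m)}}

  recip-antitone : ∀ {A P} → 1 ℕ.≤ A → A ℕ.≤ P → recip P ≤ recip A
  recip-antitone {suc a} {suc p} _ A≤P =
    subst₂ _≤_ (sym (normalize-coprime (1-coprimeTo (suc p)))) (sym (normalize-coprime (1-coprimeTo (suc a))))
      (*≤* (subst₂ ℤ._≤_ (sym (ℤP.*-identityˡ (+ suc a))) (sym (ℤP.*-identityˡ (+ suc p))) (ℤ.+≤+ A≤P)))

  fromℕ*recip : ∀ m .{{_ : ℕ.NonZero m}} → fromℕ m * recip m ≡ 1ℚ
  fromℕ*recip (suc m) = trans (cong₂ _*_ (fromℕ≡mkℚ (suc m)) (normalize-coprime (1-coprimeTo (suc m))))
                        (*-inverseʳ (mkℚ (+ suc m) 0 (Coprimality.sym (1-coprimeTo (suc m)))))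

  ½ : ℚ
  ½ = + 1 ℚ./ 2

  pos+nonNeg : ∀ {p q} → 0ℚ < p → 0ℚ ≤ q → 0ℚ < p + q
  pos+nonNeg 0<p 0≤q = +-mono-<-≤ 0<p 0≤q

  <⇒0<- : ∀ {p q} → p < q → 0ℚ < q - p
  <⇒0<- {p} {q} p<q = subst (_< q - p) (+-inverseʳ p) (+-monoˡ-< (- p) p<q)

  ≤⇒0≤- : ∀ {p q} → p ≤ q → 0ℚ ≤ q - p
  ≤⇒0≤- {p} {q} p≤q = subst (_≤ q - p) (+-inverseʳ p) (+-monoˡ-≤ (- p) p≤q)

  p<p+q : ∀ p {q} → 0ℚ < q → p < p + q
  p<p+q p 0<q = subst (_< p + _) (+-identityʳ p) (+-monoʳ-< p 0<q)

  p≤p+q : ∀ p {q} → 0ℚ ≤ q → p ≤ p + q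
  p≤p+q p 0≤q = subst (_≤ p + _) (+-identityʳ p) (+-monoʳ-≤ p 0≤q)

  *-monoˡ-≤-nonNeg′ : ∀ {r p q} → 0ℚ ≤ r → p ≤ q → r * p ≤ r * q
  *-monoˡ-≤-nonNeg′ {r} 0≤r = *-monoˡ-≤-nonNeg r {{ℚ.nonNegative 0≤r}}

  fromℕ-sumBelow : ∀ n f → fromℕ (ℕΣ.sumBelow n f) ≡ ℚΣ.sumBelow n (fromℕ ∘ f)
  fromℕ-sumBelow zero    f = refl
  fromℕ-sumBelow (suc n) f = trans (fromℕ-+ (f 0) _) (cong (_+_ (fromℕ (f 0))) (fromℕ-sumBelow n (f ∘ suc)))

  sumBelow-nonNeg : ∀ n {f} → (∀ i → 0ℚ ≤ f i) → 0ℚ ≤ ℚΣ.sumBelow n f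
  sumBelow-nonNeg zero    _    = ≤-refl
  sumBelow-nonNeg (suc n) f≥0 = +-mono-≤ (f≥0 0) (sumBelow-nonNeg n (f≥0 ∘ suc))

  sumBelow-mono-≤ : ∀ {f} → (∀ i → 0ℚ ≤ f i) → ∀ {m n} → m ℕ.≤ n → ℚΣ.sumBelow m f ≤ ℚΣ.sumBelow n f
  sumBelow-mono-≤ {f} f≥0 {m} {n} m≤n = subst (λ n → ℚΣ.sumBelow m f ≤ ℚΣ.sumBelow n f) (ℕP.m+[n∸m]≡n m≤n)
    (subst (ℚΣ.sumBelow m f ≤_) (sym (ℚΣ.sumBelow-+ m (n ℕ.∸ m) f))
      (p≤p+q _ (sumBelow-nonNeg (n ℕ.∸ m) (λ i → f≥0 (m ℕ.+ i)))))

  sumBelow-≤-* : ∀ n {f w} → (∀ i → f i ≤ w) → ℚΣ.sumBelow n f ≤ fromℕ n * w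
  sumBelow-≤-* zero    {w = w} _    = ≤-reflexive (sym (*-zeroˡ w))
  sumBelow-≤-* (suc n) {w = w} f≤w = ≤-trans (+-mono-≤ (f≤w 0) (sumBelow-≤-* n (f≤w ∘ suc)))
    (≤-reflexive (trans (solve 2 (λ w m → w :+ m :* w := (m :+ con 1ℚ) :* w) refl w (fromℕ n))
                        (cong (_* w) (sym (fromℕ-suc n)))))

  p≤∣p∣ : ∀ p → p ≤ ∣ p ∣
  p≤∣p∣ p with ∣p∣≡p∨∣p∣≡-p p
  ... | inj₁ ∣p∣≡p  = ≤-reflexive (sym ∣p∣≡p)
  ... | inj₂ ∣p∣≡-p = ≤-trans p≤0 (0≤∣p∣ p)
    where
    p≤0 : p ≤ 0ℚ
    p≤0 = subst₂ _≤_ (+-identityˡ p) (+-inverseˡ p) (+-monoˡ-≤ p (subst (0ℚ ≤_) ∣p∣≡-p (0≤∣p∣ p)))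

  -p≤∣p∣ : ∀ p → - p ≤ ∣ p ∣
  -p≤∣p∣ p = subst (- p ≤_) (∣-p∣≡∣p∣ p) (p≤∣p∣ (- p))

  ∣p∣<q⇒p<q : ∀ {p q} → ∣ p ∣ < q → p < q
  ∣p∣<q⇒p<q {p} = ≤-<-trans (p≤∣p∣ p)

  ∣p∣<q⇒-p<q : ∀ {p q} → ∣ p ∣ < q → - p < q
  ∣p∣<q⇒-p<q {p} = ≤-<-trans (-p≤∣p∣ p)

  p<q∧-p<q⇒∣p∣<q : ∀ {p q} → p < q → - p < q → ∣ p ∣ < q
  p<q∧-p<q⇒∣p∣<q {p} p<q -p<q with ∣p∣≡p∨∣p∣≡-p p
  ... | inj₁ ∣p∣≡p  = subst (_< _) (sym ∣p∣≡p) p<q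
  ... | inj₂ ∣p∣≡-p = subst (_< _) (sym ∣p∣≡-p) -p<q

  ∣p-q∣<r⇒ : ∀ {p q r} → ∣ p - q ∣ < r → q - r < p × p < q + r
  ∣p-q∣<r⇒ {p} {q} {r} h =
    subst₂ _<_ (solve 3 (λ p q r → (:- (p :- q)) :+ (p :- r) := q :- r) refl p q r)
               (solve 2 (λ p r → r :+ (p :- r) := p) refl p r)
               (+-monoˡ-< (p - r) (∣p∣<q⇒-p<q h)) ,
    subst₂ _<_ (solve 2 (λ p q → (p :- q) :+ q := p) refl p q) (+-comm r q)
               (+-monoˡ-< q (∣p∣<q⇒p<q h))

  ⇒∣p-q∣<r : ∀ {p q r} → q - r < p → p < q + r → ∣ p - q ∣ < r
  ⇒∣p-q∣<r {p} {q} {r} lower upper = p<q∧-p<q⇒∣p∣<q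
    (subst₂ _<_ refl (solve 2 (λ q r → q :+ r :- q := r) refl q r) (+-monoˡ-< (- q) upper))
    (subst₂ _<_ (solve 3 (λ p q r → q :- r :+ (r :- p) := :- (p :- q)) refl p q r)
               (solve 2 (λ p r → p :+ (r :- p) := r) refl p r)
               (+-monoˡ-< (r - p) lower))

  record Near (δ a y : ℚ) : Set where
    constructor near
    field
      lower : (1ℚ - δ) * y < a
      upper : a < (1ℚ + δ) * y

  open Near public

  Near-+ : ∀ {δ a b y z} → Near δ a y → Near δ b z → Near δ (a + b) (y + z)
  Near-+ {δ} {y = y} {z} (near lo₁ hi₁) (near lo₂ hi₂) = near
    (subst (_< _) (sym (*-distribˡ-+ (1ℚ - δ) y z)) (+-mono-< lo₁ lo₂))
    (subst (_ <_) (sym (*-distribˡ-+ (1ℚ + δ) y z)) (+-mono-< hi₁ hi₂))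

  Near-weaken : ∀ {δ ε a y} → δ ≤ ε → 0ℚ ≤ y → Near δ a y → Near ε a y
  Near-weaken {y = y} δ≤ε 0≤y (near lo hi) = near
    (≤-<-trans (*-monoʳ-≤-nonNeg y {{ℚ.nonNegative 0≤y}} (+-monoʳ-≤ 1ℚ (neg-antimono-≤ δ≤ε))) lo)
    (<-≤-trans hi (*-monoʳ-≤-nonNeg y {{ℚ.nonNegative 0≤y}} (+-monoʳ-≤ 1ℚ δ≤ε)))

  ÷-*-cancel : ∀ a {y} → 0ℚ < y → (a ÷ y) * y ≡ a
  ÷-*-cancel a {y} 0<y with y ℚ.≟ 0ℚ
  ... | yes y≡0 = contradiction 0<y (<-irrefl (sym y≡0))
  ... | no y≢0 = begin
    a * ℚ.1/ y * y   ≡⟨ *-assoc a _ y ⟩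
    a * (ℚ.1/ y * y) ≡⟨ cong (a *_) (*-inverseˡ y) ⟩
    a * 1ℚ           ≡⟨ *-identityʳ a ⟩
    a                ∎
    where
    open ≡-Reasoning
    instance _ = ℚ.≢-nonZero y≢0

  ratio⇒Near : ∀ {δ a y} → 0ℚ < y → ∣ a ÷ y - 1ℚ ∣ < δ → Near δ a y
  ratio⇒Near {δ} {a} {y} 0<y close = near
    (subst ((1ℚ - δ) * y <_) cancel (*-monoˡ-<-pos y (proj₁ bounds)))
    (subst (_< (1ℚ + δ) * y) cancel (*-monoˡ-<-pos y (proj₂ bounds)))
    where
    instance _ = ℚ.positive 0<y
    cancel : (a ÷ y) * y ≡ a
    cancel = ÷-*-cancel a 0<y
    bounds : 1ℚ - δ < a ÷ y × a ÷ y < 1ℚ + δ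
    bounds = ∣p-q∣<r⇒ {a ÷ y} {1ℚ} {δ} close

  Near⇒ratio : ∀ {δ a y} → 0ℚ < y → Near δ a y → ∣ a ÷ y - 1ℚ ∣ < δ
  Near⇒ratio {δ} {a} {y} 0<y (near lo hi) = ⇒∣p-q∣<r {a ÷ y} {1ℚ} {δ}
    (*-cancelʳ-<-nonNeg y {1ℚ - δ} {a ÷ y} (subst ((1ℚ - δ) * y <_) (sym cancel) lo))
    (*-cancelʳ-<-nonNeg y {a ÷ y} {1ℚ + δ} (subst (_< (1ℚ + δ) * y) (sym cancel) hi))
    where
    instance _ = ℚ.nonNegative (<⇒≤ 0<y)
    cancel : (a ÷ y) * y ≡ a
    cancel = ÷-*-cancel a 0<y

  Near-sum : ∀ {δ} k .{{_ : ℕ.NonZero k}} f g → (∀ p → p ℕ.< k → Near δ (f p) (g p)) →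
    Near δ (ℚΣ.sumBelow k f) (ℚΣ.sumBelow k g)
  Near-sum {δ} 1 f g near-each = subst₂ (Near δ) (sym (+-identityʳ (f 0))) (sym (+-identityʳ (g 0)))
    (near-each 0 (ℕ.s≤s ℕ.z≤n))
  Near-sum (suc k@(suc _)) f g near-each = Near-+ (near-each 0 (ℕ.s≤s ℕ.z≤n))
    (Near-sum k (f ∘ suc) (g ∘ suc) (λ p p<k → near-each (suc p) (ℕ.s≤s p<k)))

  module Interpolation {δ x y z a b c : ℚ} (0≤δ : 0ℚ ≤ δ) (δ≤½ : δ ≤ ½)
    (0≤x : 0ℚ ≤ x) (x≤y : x ≤ y) (y≤z : y ≤ z) (z≤x+½ : z ≤ x + ½) (a≤b : a ≤ b) (b≤c : b ≤ c)
    (near-a : Near δ a x) (near-c : Near δ c z) where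

    open ≤-Reasoning

    private
      0≤1-δ : 0ℚ ≤ 1ℚ - δ
      0≤1-δ = ≤⇒0≤- (≤-trans δ≤½ (toWitness {a? = ½ ≤? 1ℚ} _))
      0≤1+δ : 0ℚ ≤ 1ℚ + δ
      0≤1+δ = ≤-trans 0≤δ (subst (δ ≤_) (+-comm δ 1ℚ) (p≤p+q δ (toWitness {a? = 0ℚ ≤? 1ℚ} _)))

    near-if-no-jump : c ≡ a → Near δ b y
    near-if-no-jump c≡a = near
      (begin-strict
        (1ℚ - δ) * y ≤⟨ *-monoˡ-≤-nonNeg′ 0≤1-δ y≤z ⟩
        (1ℚ - δ) * z <⟨ lower near-c ⟩
        c            ≡⟨ c≡a ⟩
        a            ≤⟨ a≤b ⟩
        b            ∎)
      (begin-strict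
        b            ≤⟨ b≤c ⟩
        c            ≡⟨ c≡a ⟩
        a            <⟨ upper near-a ⟩
        (1ℚ + δ) * x ≤⟨ *-monoˡ-≤-nonNeg′ 0≤1+δ x≤y ⟩
        (1ℚ + δ) * y ∎)

    -- The jump of at least 1 has to fit into (1 + δ)(x + ½) - (1 - δ)x = 2δx + (1 + δ)/2.
    x-large-if-jump : a + 1ℚ ≤ c → 1ℚ < fromℕ 8 * δ * x
    x-large-if-jump a+1≤c = begin-strict
      1ℚ                                ≤⟨ p≤p+q 1ℚ (≤⇒0≤- δ+δ≤1) ⟩
      1ℚ + (1ℚ - (δ + δ))               <⟨ p<p+q _ 0<4gap ⟩
      1ℚ + (1ℚ - (δ + δ)) + fromℕ 4 * gap ≡⟨ solve 2 (λ δ x →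
        con 1ℚ :+ (con 1ℚ :- (δ :+ δ))
          :+ con (fromℕ 4) :* ((con 1ℚ :+ δ) :* (x :+ con ½) :- ((con 1ℚ :- δ) :* x :+ con 1ℚ))
        := con (fromℕ 8) :* δ :* x) refl δ x ⟩
      fromℕ 8 * δ * x                   ∎
      where
      δ+δ≤1 : δ + δ ≤ 1ℚ
      δ+δ≤1 = +-mono-≤ δ≤½ δ≤½
      jump-in-window : (1ℚ - δ) * x + 1ℚ < (1ℚ + δ) * (x + ½)
      jump-in-window = begin-strict
        (1ℚ - δ) * x + 1ℚ ≤⟨ +-monoˡ-≤ 1ℚ (<⇒≤ (lower near-a)) ⟩
        a + 1ℚ            ≤⟨ a+1≤c ⟩
        c                 <⟨ upper near-c ⟩
        (1ℚ + δ) * z      ≤⟨ *-monoˡ-≤-nonNeg′ 0≤1+δ z≤x+½ ⟩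
        (1ℚ + δ) * (x + ½) ∎
      gap : ℚ
      gap = (1ℚ + δ) * (x + ½) - ((1ℚ - δ) * x + 1ℚ)
      0<4gap : 0ℚ < fromℕ 4 * gap
      0<4gap = subst (_< fromℕ 4 * gap) (*-zeroʳ (fromℕ 4)) (*-monoʳ-<-pos (fromℕ 4) (<⇒0<- jump-in-window))

    near-if-jump : a + 1ℚ ≤ c → Near (fromℕ 9 * δ) b y
    near-if-jump a+1≤c = near
      (begin-strict
        (1ℚ - fromℕ 9 * δ) * y    ≡⟨ solve 2 (λ δ y → (con 1ℚ :- con (fromℕ 9) :* δ) :* y
                                       := y :- con (fromℕ 9) :* δ :* y) refl δ y ⟩
        y - fromℕ 9 * δ * y       ≤⟨ +-monoʳ-≤ y (neg-antimono-≤ (*-monoˡ-≤-nonNeg′ (0≤k*δ 9) x≤y)) ⟩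
        y - fromℕ 9 * δ * x       ≤⟨ +-monoˡ-≤ (- (fromℕ 9 * δ * x)) (≤-trans y≤z z≤x+½) ⟩
        x + ½ - fromℕ 9 * δ * x   <⟨ +-monoˡ-< (- (fromℕ 9 * δ * x))
                                       (+-monoʳ-< x (<-trans (toWitness {a? = ½ <? 1ℚ} _) large)) ⟩
        x + fromℕ 8 * δ * x - fromℕ 9 * δ * x ≡⟨ solve 2 (λ δ x →
                                        x :+ con (fromℕ 8) :* δ :* x :- con (fromℕ 9) :* δ :* x
                                          := (con 1ℚ :- δ) :* x) refl δ x ⟩
        (1ℚ - δ) * x              <⟨ lower near-a ⟩
        a                         ≤⟨ a≤b ⟩
        b                         ∎)
      (begin-strict
        b                         ≤⟨ b≤c ⟩
        c                         <⟨ upper near-c ⟩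
        (1ℚ + δ) * z              ≤⟨ *-monoˡ-≤-nonNeg′ 0≤1+δ (≤-trans z≤x+½ (+-monoˡ-≤ ½ x≤y)) ⟩
        (1ℚ + δ) * (y + ½)        ≡⟨ *-distribˡ-+ (1ℚ + δ) y ½ ⟩
        (1ℚ + δ) * y + (1ℚ + δ) * ½ ≤⟨ +-monoʳ-≤ ((1ℚ + δ) * y) [1+δ]*½≤1 ⟩
        (1ℚ + δ) * y + 1ℚ         <⟨ +-monoʳ-< ((1ℚ + δ) * y)
                                       (<-≤-trans large (*-monoˡ-≤-nonNeg′ (0≤k*δ 8) x≤y)) ⟩
        (1ℚ + δ) * y + fromℕ 8 * δ * y ≡⟨ solve 2 (λ δ y → (con 1ℚ :+ δ) :* y :+ con (fromℕ 8) :* δ :* y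
                                       := (con 1ℚ :+ con (fromℕ 9) :* δ) :* y) refl δ y ⟩
        (1ℚ + fromℕ 9 * δ) * y    ∎)
      where
      large : 1ℚ < fromℕ 8 * δ * x
      large = x-large-if-jump a+1≤c
      0≤k*δ : ∀ k → 0ℚ ≤ fromℕ k * δ
      0≤k*δ k = subst (_≤ fromℕ k * δ) (*-zeroʳ (fromℕ k)) (*-monoˡ-≤-nonNeg′ (fromℕ-nonNeg k) 0≤δ)
      [1+δ]*½≤1 : (1ℚ + δ) * ½ ≤ 1ℚ
      [1+δ]*½≤1 = *-monoʳ-≤-nonNeg ½ (+-monoʳ-≤ 1ℚ (≤-trans δ≤½ (toWitness {a? = ½ ≤? 1ℚ} _)))

    near-between : c ≡ a ⊎ a + 1ℚ ≤ c → Near (fromℕ 9 * δ) b y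
    near-between (inj₁ c≡a)   = Near-weaken δ≤9δ (≤-trans 0≤x x≤y) (near-if-no-jump c≡a)
      where
      δ≤9δ : δ ≤ fromℕ 9 * δ
      δ≤9δ = subst (_≤ fromℕ 9 * δ) (*-identityˡ δ)
               (*-monoʳ-≤-nonNeg δ {{ℚ.nonNegative 0≤δ}} (toWitness {a? = 1ℚ ≤? fromℕ 9} _))
    near-between (inj₂ a+1≤c) = near-if-jump a+1≤c

  Eventually : (ℕ → Set) → Set
  Eventually P = ∃ λ N → ∀ n → N ℕ.≤ n → P n

  eventually-mono : ∀ {P Q : ℕ → Set} → (∀ {n} → P n → Q n) → Eventually P → Eventually Q
  eventually-mono P⇒Q (N , P≥N) = N , λ n N≤n → P⇒Q (P≥N n N≤n)

  eventually-× : ∀ {P Q : ℕ → Set} → Eventually P → Eventually Q → Eventually (λ n → P n × Q n)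
  eventually-× (M , P≥M) (N , Q≥N) = M ℕ.⊔ N , λ n M⊔N≤n →
    P≥M n (ℕP.≤-trans (ℕP.m≤m⊔n M N) M⊔N≤n) , Q≥N n (ℕP.≤-trans (ℕP.m≤n⊔m M N) M⊔N≤n)

  eventually-∀< : ∀ {P : ℕ → ℕ → Set} k → (∀ p → p ℕ.< k → Eventually (P p)) →
    Eventually (λ n → ∀ p → p ℕ.< k → P p n)
  eventually-∀< zero    _  = 0 , λ _ _ _ ()
  eventually-∀< (suc k) ev with eventually-× (ev 0 (ℕ.s≤s ℕ.z≤n))
                                   (eventually-∀< k (λ p p<k → ev (suc p) (ℕ.s≤s p<k)))
  ... | N , both = N , λ where
    n N≤n zero    _           → proj₁ (both n N≤n)
    n N≤n (suc p) (ℕ.s≤s p<k) → proj₂ (both n N≤n) p p<k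

  _∼_ : (ℕ → ℚ) → (ℕ → ℚ) → Set
  a ∼ y = ∀ δ → 0ℚ < δ → Eventually (λ n → Near δ (a n) (y n))

  ∼-cong : ∀ {a a′ y y′} → (∀ n → a n ≡ a′ n) → (∀ n → y n ≡ y′ n) → a ∼ y → a′ ∼ y′
  ∼-cong a≗a′ y≗y′ a∼y δ 0<δ = eventually-mono (λ {n} → subst₂ (Near δ) (a≗a′ n) (y≗y′ n)) (a∼y δ 0<δ)

  ∼-subsequence : ∀ {a y} (g : ℕ → ℕ) → (∀ t → t ℕ.≤ g t) → a ∼ y → (a ∘ g) ∼ (y ∘ g)
  ∼-subsequence g t≤g a∼y δ 0<δ with a∼y δ 0<δ
  ... | N , near-from = N , λ t N≤t → near-from (g t) (ℕP.≤-trans N≤t (t≤g t))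

  ∼-sum : ∀ k .{{_ : ℕ.NonZero k}} (a y : ℕ → ℕ → ℚ) → (∀ p → p ℕ.< k → a p ∼ y p) →
    (λ n → ℚΣ.sumBelow k (λ p → a p n)) ∼ (λ n → ℚΣ.sumBelow k (λ p → y p n))
  ∼-sum k a y a∼y δ 0<δ = eventually-mono (Near-sum k _ _)
    (eventually-∀< k (λ p p<k → a∼y p p<k δ 0<δ))

  ratio⇒∼ : ∀ {a y} → Eventually (λ n → 0ℚ < y n) → TendsToOne (λ n → a n ÷ y n) → a ∼ y
  ratio⇒∼ pos tends δ 0<δ = eventually-mono (λ (0<y , close) → ratio⇒Near 0<y close)
    (eventually-× pos (tends δ 0<δ))

  ∼⇒ratio : ∀ {a y} → Eventually (λ n → 0ℚ < y n) → a ∼ y → TendsToOne (λ n → a n ÷ y n)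
  ∼⇒ratio pos a∼y δ 0<δ = eventually-mono (λ (0<y , close) → Near⇒ratio 0<y close)
    (eventually-× pos (a∼y δ 0<δ))

  ∼-if-small : ∀ {a y} → Eventually (λ n → 0ℚ ≤ y n) →
    (∀ δ → 0ℚ < δ → δ ≤ 1ℚ → Eventually (λ n → Near δ (a n) (y n))) → a ∼ y
  ∼-if-small nonNeg small ε 0<ε with ≤-total ε 1ℚ
  ... | inj₁ ε≤1 = small ε 0<ε ε≤1
  ... | inj₂ 1≤ε = eventually-mono (λ (0≤y , close) → Near-weaken 1≤ε 0≤y close)
                     (eventually-× nonNeg (small 1ℚ (toWitness {a? = 0ℚ <? 1ℚ} _) ≤-refl))

  module _ (k : ℕ) .{{_ : ℕ.NonZero k}} where

    open import Data.Nat.DivMod using (_/_; m/n*n≤m; m%n<n; m≡m%n+[m/n]*n; /-monoˡ-≤; m*n/n≡m)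

    n<[1+n/k]*k : ∀ n → n ℕ.< suc (n / k) ℕ.* k
    n<[1+n/k]*k n = subst (ℕ._< k ℕ.+ n / k ℕ.* k) (sym (m≡m%n+[m/n]*n n k))
                      (ℕP.+-monoˡ-< (n / k ℕ.* k) (m%n<n n k))

    ∼-from-multiples : ∀ (a : ℕ → ℕ) (y : ℕ → ℚ) →
      (∀ {m n} → m ℕ.≤ n → a m ℕ.≤ a n) → (∀ {m n} → m ℕ.≤ n → y m ≤ y n) →
      (∀ n → 1 ℕ.≤ n → 0ℚ < y n) → (∀ n → y (n ℕ.+ k) ≤ y n + ½) →
      (λ t → fromℕ (a (suc t ℕ.* k))) ∼ (λ t → y (suc t ℕ.* k)) →
      (λ n → fromℕ (a n)) ∼ y
    ∼-from-multiples a y a-mono y-mono y-pos y-step along =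
      ∼-if-small (1 , λ n 1≤n → <⇒≤ (y-pos n 1≤n)) small
      where
      small : ∀ ε → 0ℚ < ε → ε ≤ 1ℚ → Eventually (λ n → Near ε (fromℕ (a n)) (y n))
      small ε 0<ε ε≤1 = suc T ℕ.* k , λ n [1+T]*k≤n →
        near-in-window (n / k) n
          (subst (ℕ._≤ n / k) (m*n/n≡m (suc T) k) (/-monoˡ-≤ k [1+T]*k≤n))
          (m/n*n≤m n k) (ℕP.<⇒≤ (n<[1+n/k]*k n))
        where
        ninth : ℚ
        ninth = + 1 ℚ./ 9
        δ : ℚ
        δ = ε * ninth
        9δ≡ε : fromℕ 9 * δ ≡ ε
        9δ≡ε = solve 1 (λ ε → con (fromℕ 9) :* (ε :* con ninth) := ε) refl ε
        0<δ : 0ℚ < δ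
        0<δ = subst (_< δ) (*-zeroˡ ninth) (*-monoˡ-<-pos ninth 0<ε)
        δ≤½ : δ ≤ ½
        δ≤½ = ≤-trans (*-monoʳ-≤-nonNeg ninth ε≤1) (toWitness {a? = 1ℚ * ninth ≤? ½} _)
        T : ℕ
        T = proj₁ (along δ 0<δ)
        near-at : ∀ t → T ℕ.≤ t → Near δ (fromℕ (a (suc t ℕ.* k))) (y (suc t ℕ.* k))
        near-at = proj₂ (along δ 0<δ)
        near-in-window : ∀ t n → suc T ℕ.≤ t → t ℕ.* k ℕ.≤ n → n ℕ.≤ suc t ℕ.* k →
          Near ε (fromℕ (a n)) (y n)
        near-in-window (suc s) n (ℕ.s≤s T≤s) M≤n n≤M′ = subst (λ e → Near e _ _) 9δ≡ε
          (Interpolation.near-between (<⇒≤ 0<δ) δ≤½ (<⇒≤ (y-pos M 1≤M)) (y-mono M≤n) (y-mono n≤M′)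
            y-window (fromℕ-mono-≤ (a-mono M≤n)) (fromℕ-mono-≤ (a-mono n≤M′))
            (near-at s T≤s) (near-at (suc s) (ℕP.m≤n⇒m≤1+n T≤s))
            (fromℕ-jump (a-mono (ℕP.m≤n+m M k))))
          where
          M : ℕ
          M = suc s ℕ.* k
          1≤M : 1 ℕ.≤ M
          1≤M = ℕP.*-mono-≤ {1} {suc s} (ℕ.s≤s ℕ.z≤n) (ℕ.>-nonZero⁻¹ k)
          y-window : y (k ℕ.+ M) ≤ y M + ½
          y-window = subst (λ m → y m ≤ y M + ½) (ℕP.+-comm M k) (y-step M)

open RelativeError

module Counting where

  open import Data.Nat using (_+_; _*_; _∸_; _^_; _≤_; _<_; s≤s; z≤n; NonZero; _<?_)
  open import Data.Nat.DivMod using (_/_; m*n/n≡m; m<n⇒m/n≡0; +-distrib-/-∣ˡ)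
  open import Data.Nat.Divisibility using (n∣m*n)
  open import Data.List using (List; []; _∷_; map; upTo; applyUpTo; foldr)
  open import Data.List.Properties using (≡-dec)
  open import Data.Rational using (ℚ; 0ℚ; 1ℚ)
  import Data.Rational as ℚ
  open +-*-Solver using (solve; _:=_; _:*_; con)

  indicator : List ℕ → List ℕ → ℕ
  indicator u B with ≡-dec ℕ._≟_ u B
  ... | yes _ = 1
  ... | no _  = 0

  countWhere-applyUpTo : ∀ w B h n →
    countWhere w B (applyUpTo h n) ≡ ℕΣ.sumBelow n (λ i → indicator (w (h i)) B)
  countWhere-applyUpTo w B h zero    = refl
  countWhere-applyUpTo w B h (suc n) with ≡-dec ℕ._≟_ (w (h 0)) B
  ... | yes _ = cong suc (countWhere-applyUpTo w B (h ∘ suc) n)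
  ... | no _  = countWhere-applyUpTo w B (h ∘ suc) n

  map-applyUpTo : ∀ {A B : Set} (g : A → B) (h : ℕ → A) n → map g (applyUpTo h n) ≡ applyUpTo (g ∘ h) n
  map-applyUpTo g h zero    = refl
  map-applyUpTo g h (suc n) = cong (g (h 0) ∷_) (map-applyUpTo g (h ∘ suc) n)

  sumℚ-applyUpTo : ∀ f n → sumℚ (applyUpTo f n) ≡ ℚΣ.sumBelow n f
  sumℚ-applyUpTo f zero    = refl
  sumℚ-applyUpTo f (suc n) = cong (ℚ._+_ (f 0)) (sumℚ-applyUpTo (f ∘ suc) n)

  Nc≡sumBelow : ∀ E B n → Nc E B n ≡ ℕΣ.sumBelow n (λ i → indicator (window E (suc i) (length B)) B)
  Nc≡sumBelow E B n = trans (cong (countWhere _ B) (map-applyUpTo suc id n)) (countWhere-applyUpTo _ B suc n)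

  Qk≡sumBelow : ∀ q k n → Qk q k n ≡ ℚΣ.sumBelow n (λ i → recip (prodQ q (suc i) k))
  Qk≡sumBelow q k n = trans (cong (λ js → sumℚ (map _ js)) (map-applyUpTo suc id n))
                            (trans (cong sumℚ (map-applyUpTo _ suc n)) (sumℚ-applyUpTo _ n))

  -- jsBelow filters with a local function that Defs does not export; the meta below is
  -- solved by unification with that function, so filterBelow is it, under a usable name.
  mutual
    filterBelow : ℕ → ℕ → List ℕ → List ℕ
    filterBelow n k = _

    jsBelow≡filterBelow : ∀ n k → jsBelow n k ≡ filterBelow n k (upTo n)
    jsBelow≡filterBelow n k with upTo n
    ... | js = refl

  filterBelow-none : ∀ n k f b → (∀ i → n ≤ f i * k) → filterBelow n k (applyUpTo f b) ≡ []
  filterBelow-none n k f zero    _    = refl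
  filterBelow-none n k f (suc b) n≤fk with f 0 * k <? n
  ... | yes f0k<n = contradiction (n≤fk 0) (ℕP.<⇒≱ f0k<n)
  ... | no _      = filterBelow-none n k (f ∘ suc) b (n≤fk ∘ suc)

  filterBelow-prefix : ∀ n k f a b → (∀ i → i < a → f i * k < n) → (∀ i → n ≤ f (a + i) * k) →
    filterBelow n k (applyUpTo f (a + b)) ≡ applyUpTo f a
  filterBelow-prefix n k f zero    b _     n≤fk = filterBelow-none n k f b n≤fk
  filterBelow-prefix n k f (suc a) b fk<n n≤fk with f 0 * k <? n
  ... | yes _     = cong (f 0 ∷_) (filterBelow-prefix n k (f ∘ suc) a b (λ i i<a → fk<n (suc i) (s≤s i<a)) n≤fk)
  ... | no f0k≮n = contradiction (fk<n 0 (s≤s z≤n)) f0k≮n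

  jsBelow-multiple : ∀ m k .{{_ : NonZero k}} → jsBelow (m * k) k ≡ upTo m
  jsBelow-multiple m k = begin
    jsBelow (m * k) k                              ≡⟨ jsBelow≡filterBelow (m * k) k ⟩
    filterBelow (m * k) k (upTo (m * k))           ≡⟨ cong (filterBelow (m * k) k ∘ upTo) (sym (ℕP.m+[n∸m]≡n m≤mk)) ⟩
    filterBelow (m * k) k (upTo (m + (m * k ∸ m))) ≡⟨ filterBelow-prefix (m * k) k id m (m * k ∸ m)
                                                        (λ i i<m → ℕP.*-monoˡ-< k i<m)
                                                        (λ i → ℕP.*-monoˡ-≤ k (ℕP.m≤m+n m i)) ⟩
    upTo m                                         ∎
    where
    open ≡-Reasoning
    m≤mk : m ≤ m * k
    m≤mk = ℕP.m≤m*n m k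

  ρ-multiple : ∀ m k .{{_ : NonZero k}} → ρ (m * k) k ≡ m ∸ 1
  ρ-multiple m (suc k) = cong (_∸ 1) (begin
    (m * suc k + k) / suc k         ≡⟨ +-distrib-/-∣ˡ k (n∣m*n m) ⟩
    m * suc k / suc k + k / suc k   ≡⟨ cong₂ _+_ (m*n/n≡m m (suc k)) (m<n⇒m/n≡0 (ℕP.n<1+n k)) ⟩
    m + 0                           ≡⟨ ℕP.+-identityʳ m ⟩
    m                               ∎)
    where open ≡-Reasoning

  Np-multiple : ∀ E B m p .{{_ : NonZero (length B)}} →
    Np E B (m * length B) p ≡ ℕΣ.sumBelow m (λ j → indicator (window E (j * length B + p) (length B)) B)
  Np-multiple E B m p = trans (cong (countWhere _ B) (jsBelow-multiple m (length B)))
                              (countWhere-applyUpTo _ B id m)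

  Qp-multiple : ∀ q k m p .{{_ : NonZero k}} →
    Qp q k (suc m * k) p ≡ ℚΣ.sumBelow (suc m) (λ j → recip (prodQ q (j * k + p) k))
  Qp-multiple q k m p = begin
    sumℚ (map R (upTo (suc (ρ (suc m * k) k)))) ≡⟨ cong (λ t → sumℚ (map R (upTo (suc t)))) (ρ-multiple (suc m) k) ⟩
    sumℚ (map R (upTo (suc m)))                 ≡⟨ cong sumℚ (map-applyUpTo R id (suc m)) ⟩
    sumℚ (applyUpTo R (suc m))                  ≡⟨ sumℚ-applyUpTo R (suc m) ⟩
    ℚΣ.sumBelow (suc m) R                       ∎
    where
    open ≡-Reasoning
    R : ℕ → ℚ
    R j = recip (prodQ q (j * k + p) k)

  Nc-residues : ∀ E B m .{{_ : NonZero (length B)}} →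
    Nc E B (m * length B) ≡ ℕΣ.sumBelow (length B) (λ p → Np E B (m * length B) (suc p))
  Nc-residues E B m = begin
    Nc E B (m * L)                                             ≡⟨ Nc≡sumBelow E B (m * L) ⟩
    ℕΣ.sumBelow (m * L) (λ i → I (suc i))                      ≡⟨ ℕΣ.sumBelow-residues m L (λ i → I (suc i)) ⟩
    ℕΣ.sumBelow L (λ p → ℕΣ.sumBelow m (λ j → I (suc (j * L + p))))
      ≡⟨ ℕΣ.sumBelow-cong L (λ p → ℕΣ.sumBelow-cong m (λ j → cong I (sym (ℕP.+-suc (j * L) p)))) ⟩
    ℕΣ.sumBelow L (λ p → ℕΣ.sumBelow m (λ j → I (j * L + suc p)))
      ≡⟨ ℕΣ.sumBelow-cong L (λ p → sym (Np-multiple E B m (suc p))) ⟩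
    ℕΣ.sumBelow L (λ p → Np E B (m * L) (suc p))               ∎
    where
    open ≡-Reasoning
    L = length B
    I : ℕ → ℕ
    I j = indicator (window E j L) B

  Qk-residues : ∀ q k m .{{_ : NonZero k}} →
    Qk q k (suc m * k) ≡ ℚΣ.sumBelow k (λ p → Qp q k (suc m * k) (suc p))
  Qk-residues q k m = begin
    Qk q k (suc m * k)                                          ≡⟨ Qk≡sumBelow q k (suc m * k) ⟩
    ℚΣ.sumBelow (suc m * k) (λ i → R (suc i))                   ≡⟨ ℚΣ.sumBelow-residues (suc m) k (λ i → R (suc i)) ⟩
    ℚΣ.sumBelow k (λ p → ℚΣ.sumBelow (suc m) (λ j → R (suc (j * k + p))))
      ≡⟨ ℚΣ.sumBelow-cong k (λ p → ℚΣ.sumBelow-cong (suc m) (λ j → cong R (sym (ℕP.+-suc (j * k) p)))) ⟩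
    ℚΣ.sumBelow k (λ p → ℚΣ.sumBelow (suc m) (λ j → R (j * k + suc p)))
      ≡⟨ ℚΣ.sumBelow-cong k (λ p → sym (Qp-multiple q k m (suc p))) ⟩
    ℚΣ.sumBelow k (λ p → Qp q k (suc m * k) (suc p))             ∎
    where
    open ≡-Reasoning
    R : ℕ → ℚ
    R j = recip (prodQ q j k)

  2^n≤product : ∀ f n → (∀ i → 2 ≤ f i) → 2 ^ n ≤ foldr _*_ 1 (applyUpTo f n)
  2^n≤product f zero    _    = ℕP.≤-refl
  2^n≤product f (suc n) 2≤f = ℕP.*-mono-≤ (2≤f 0) (2^n≤product (f ∘ suc) n (2≤f ∘ suc))

  2^k≤prodQ : ∀ q → IsBasic q → ∀ j k → 1 ≤ j → 2 ^ k ≤ prodQ q j k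
  2^k≤prodQ q basic j k 1≤j = subst (2 ^ k ≤_) (cong (foldr _*_ 1) (sym (map-applyUpTo _ id k)))
    (2^n≤product _ k (λ i → basic (j + i) (ℕP.≤-trans 1≤j (ℕP.m≤m+n j i))))

  1+n≤2^n : ∀ n → suc n ≤ 2 ^ n
  1+n≤2^n zero    = ℕP.≤-refl
  1+n≤2^n (suc n) = ℕP.+-mono-≤ (ℕP.m^n>0 2 n) (ℕP.≤-trans (1+n≤2^n n) (ℕP.m≤m+n _ 0))

  2n≤2^n : ∀ n → 2 * n ≤ 2 ^ n
  2n≤2^n zero    = z≤n
  2n≤2^n (suc n) = ℕP.*-monoʳ-≤ 2 (1+n≤2^n n)

  k*recip[2k]≡½ : ∀ k .{{_ : NonZero k}} → fromℕ k ℚ.* recip (2 * k) ≡ ½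
  k*recip[2k]≡½ k = begin
    fromℕ k ℚ.* r                                ≡⟨ solve 2 (λ k r → k :* r := (con (fromℕ 2) :* k :* r) :* con ½) refl (fromℕ k) r ⟩
    (fromℕ 2 ℚ.* fromℕ k ℚ.* r) ℚ.* ½            ≡⟨ cong (λ t → t ℚ.* r ℚ.* ½) (sym (fromℕ-* 2 k)) ⟩
    (fromℕ (2 * k) ℚ.* r) ℚ.* ½                  ≡⟨ cong (ℚ._* ½) (fromℕ*recip (2 * k) {{ℕP.m*n≢0 2 k}}) ⟩
    1ℚ ℚ.* ½                                     ≡⟨ ℚP.*-identityˡ ½ ⟩
    ½                                            ∎
    where
    open ≡-Reasoning
    r = recip (2 * k)

  Qk[n+k]≤Qk[n]+½ : ∀ q → IsBasic q → ∀ k .{{_ : NonZero k}} n → Qk q k (n + k) ℚ.≤ Qk q k n ℚ.+ ½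
  Qk[n+k]≤Qk[n]+½ q basic k n = subst₂ ℚ._≤_ (sym (trans (Qk≡sumBelow q k (n + k)) (ℚΣ.sumBelow-+ n k R)))
    (cong (ℚ._+ ½) (sym (Qk≡sumBelow q k n)))
    (ℚP.+-monoʳ-≤ (ℚΣ.sumBelow n R) (ℚP.≤-trans
      (sumBelow-≤-* k (λ i → recip-antitone (ℕP.≤-trans (ℕ.>-nonZero⁻¹ k) (ℕP.m≤n*m k 2))
        (ℕP.≤-trans (2n≤2^n k) (2^k≤prodQ q basic (suc (n + i)) k (s≤s z≤n)))))
      (ℚP.≤-reflexive (k*recip[2k]≡½ k))))
    where
    R : ℕ → ℚ
    R i = recip (prodQ q (suc i) k)

  Nc-mono : ∀ E B {m n} → m ≤ n → Nc E B m ≤ Nc E B n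
  Nc-mono E B {m} {n} m≤n = subst₂ _≤_ (sym (Nc≡sumBelow E B m)) (sym (Nc≡sumBelow E B n))
    (subst (λ n → ℕΣ.sumBelow m I ≤ ℕΣ.sumBelow n I) (ℕP.m+[n∸m]≡n m≤n)
      (subst (ℕΣ.sumBelow m I ≤_) (sym (ℕΣ.sumBelow-+ m (n ∸ m) I)) (ℕP.m≤m+n _ _)))
    where
    I : ℕ → ℕ
    I i = indicator (window E (suc i) (length B)) B

  Qk-mono : ∀ q k {m n} → m ≤ n → Qk q k m ℚ.≤ Qk q k n
  Qk-mono q k {m} {n} m≤n = subst₂ ℚ._≤_ (sym (Qk≡sumBelow q k m)) (sym (Qk≡sumBelow q k n))
    (sumBelow-mono-≤ (λ i → recip-nonNeg (prodQ q (suc i) k)) m≤n)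

  Qk-pos : ∀ q → IsBasic q → ∀ k n → 1 ≤ n → 0ℚ ℚ.< Qk q k n
  Qk-pos q basic k (suc n) _ = subst (0ℚ ℚ.<_) (sym (Qk≡sumBelow q k (suc n)))
    (pos+nonNeg (recip-pos (ℕP.≤-trans (ℕP.m^n>0 2 k) (2^k≤prodQ q basic 1 k ℕP.≤-refl)))
                (sumBelow-nonNeg n (λ i → recip-nonNeg (prodQ q (suc (suc i)) k))))

  Qp-pos : ∀ q → IsBasic q → ∀ k n p → 1 ≤ p → 0ℚ ℚ.< Qp q k n p
  Qp-pos q basic k n p 1≤p =
    pos+nonNeg (recip-pos (ℕP.≤-trans (ℕP.m^n>0 2 k) (2^k≤prodQ q basic p k 1≤p)))
      (subst (0ℚ ℚ.≤_) (sym (trans (cong sumℚ (map-applyUpTo R suc (ρ n k))) (sumℚ-applyUpTo (R ∘ suc) (ρ n k))))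
        (sumBelow-nonNeg (ρ n k) (λ j → recip-nonNeg (prodQ q (suc j * k + p) k))))
    where
    R : ℕ → ℚ
    R j = recip (prodQ q (j * k + p) k)

open Counting

normal-on-block : ∀ q E → IsBasic q → IsStronglyQNormal q E → ∀ B .{{_ : ℕ.NonZero (length B)}} →
  (λ n → fromℕ (Nc E B n)) ∼ Qk q (length B)
normal-on-block q E basic strong B =
  ∼-from-multiples L (Nc E B) (Qk q L) (Nc-mono E B) (Qk-mono q L) (Qk-pos q basic L) (Qk[n+k]≤Qk[n]+½ q basic L)
    (∼-cong (λ t → sym (trans (cong fromℕ (Nc-residues E B (suc t))) (fromℕ-sumBelow L _)))
            (λ t → sym (Qk-residues q L t))
            (∼-sum L _ _ λ p p<L → ∼-subsequence multiple t≤multiple (residue-class p p<L)))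
  where
  L = length B
  residue-class : ∀ p → p ℕ.< L → (λ n → fromℕ (Np E B n (suc p))) ∼ (λ n → Qp q L n (suc p))
  residue-class p p<L = ratio⇒∼ (0 , λ n _ → Qp-pos q basic L n (suc p) (ℕ.s≤s ℕ.z≤n))
    (strong L (ℕ.>-nonZero⁻¹ L) B ℕP.≤-refl (suc p) (ℕ.s≤s ℕ.z≤n) p<L)
  multiple : ℕ → ℕ
  multiple t = suc t ℕ.* L
  t≤multiple : ∀ t → t ℕ.≤ multiple t
  t≤multiple t = ℕP.≤-trans (ℕP.n≤1+n t) (ℕP.m≤m*n (suc t) L)

mainTheorem8 : (q E : ℕ → ℕ) → IsBasic q → IsCantorDigits q E →
  IsStronglyQNormal q E → IsQNormal q E
mainTheorem8 q E basic _ strong .(length B) 1≤L B refl =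
  ∼⇒ratio (1 , Qk-pos q basic (length B)) (normal-on-block q E basic strong B {{ℕ.>-nonZero 1≤L}})
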